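{- Let $(\mathbf{R},\mathbb{I})$ be a realizer category such that $\partial_{\mathbf{R}}$ is an isomorphism of double categories. Let $X=(X,A,\Vert-\Vert_X)$ be a partitioned groupoidal assembly, and suppose given an equivalence of groupoids $F:X\to Y$, $G:Y\to X$, $\phi:\mathrm{id}_X\Rightarrow GF$, $\psi:\mathrm{id}_Y\Rightarrow FG$ in $\mathbf{Gpd}$. Then $Y$ can be equipped with the structure of a partitioned groupoidal assembly (a realizer type and realizability functor) such that $F,G,\phi,\psi$ form an equivalence in the 2-category $\mathbf{PGAsm}(\mathbf{R},\mathbb{I})$. Moreover, if $X$ is modest then so is $Y$ with this structure.
   Context: Let $\mathbf{R}$ be a cartesian closed category with terminal object $1$ and $\mathbb{I}$ an interval in $\mathbf{R}$: an internal cogroupoid with objects $\mathbb{I}_0=1,\mathbb{I}_1,\mathbb{I}_2,\mathbb{I}_3$, maps $0,1:\mathbb{I}_0\to\mathbb{I}_1$, $*:\mathbb{I}_1\to\mathbb{I}_0$, $\sigma:\mathbb{I}_1\to\mathbb{I}_1$, $i_0,i_1,2:\mathbb{I}_1\to\mathbb{I}_2$, $j_0,j_1:\mathbb{I}_2\to\mathbb{I}_3$, with $i_0\circ1=i_1\circ0$ and $j_1i_0=j_0i_1$ pushout squares and the cogroupoid axioms holding (equivalently, for each $A$ the following data form a groupoid $\Pi A$): objects maps $a:\mathbb{I}_0\to A$, morphisms $\alpha:a\to b$ maps $\alpha:\mathbb{I}_1\to A$ with $\alpha0=a,\alpha1=b$, composite $[\beta,\alpha]\circ2$ (where $[\beta,\alpha]i_0=\alpha$,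 $[\beta,\alpha]i_1=\beta$), identity $a*$, inverse $\alpha\sigma$; $\Pi(f)$ is postcomposition. $(\mathbf{R},\mathbb{I})$ is a realizer category. Homotopies $H:f\Rightarrow g:A\to B$ are maps $H:A\times\mathbb{I}_1\to B$ with $H\langle\mathrm{id},0!\rangle=f$, $H\langle\mathrm{id},1!\rangle=g$; they form a groupoid with composition $[H',H]\circ(A\times2)$. "$\partial_{\mathbf{R}}$ is an isomorphism" means every commuting square of homotopies between maps $A\to B$ is the boundary of a unique map $A\times\mathbb{I}_1\times\mathbb{I}_1\to B$. A partitioned groupoidal assembly is $(X,A,\Vert-\Vert_X)$ with $X$ a small groupoid, $A\in\mathbf{R}$ and $\Vert-\Vert_X:X\to\Pi A$ a functor; modest if $\Vert-\Vert_X$ is fully faithful. Morphisms $(X,A,\Vert-\Vert_X)\to(Y,B,\Vert-\Vert_Y)$ of $\mathbf{PGAsm}(\mathbf{R},\mathbb{I})$ are functors $F$ admitting $e:A\to B$ and a natural iso $\epsilon:\Pi(e)\Vert-\Vert_X\Rightarrow\Vert-\Vert_YF$. Products are formed componentwise with paired realizability functors. With $\mathbf{I}_1$ = (walking isomorphism $i:0\to1$, realizer type $\mathbb{I}_1$, $\Vert0\Vert=0$, $\Vert1\Vert=1$, $\Vert i\Vert=\mathrm{id}_{\mathbb{I}_1}$), 2-cells $F\Rightarrow G$ are morphisms $X\times\mathbf{I}_1\to Y$ restricting to $F$ and $G$ at $0$ and $1$, i.e. natural isomorphisms that are realized; this makes $\mathbf{PGAsm}(\mathbf{R},\mathbb{I})$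 a (2,1)-category, in which equivalences are understood. -}

module Defs where

open import Level using (Level; _⊔_) renaming (suc to lsuc)
open import Data.Bool using (Bool; false; true)
open import Data.Unit.Polymorphic using (⊤; tt)
open import Data.Product using (Σ; Σ-syntax; _×_; _,_; proj₁; proj₂)
open import Relation.Binary using (Rel; IsEquivalence; Setoid)
import Relation.Binary.Reasoning.Setoid as SetoidR

record Category (o ℓ e : Level) : Set (lsuc (o ⊔ ℓ ⊔ e)) where
  infix  4 _≈_ _⇒_
  infixr 9 _∘_
  field
    Obj       : Set o
    _⇒_       : Obj → Obj → Set ℓ
    _≈_       : ∀ {A B} → Rel (A ⇒ B) e
    id        : ∀ {A} → A ⇒ A
    _∘_       : ∀ {A B C} → B ⇒ C → A ⇒ B → A ⇒ C
    equiv     : ∀ {A B} → IsEquivalence (_≈_ {A} {B})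
    ∘-resp-≈  : ∀ {A B C} {f h : B ⇒ C} {g i : A ⇒ B} → f ≈ h → g ≈ i → f ∘ g ≈ h ∘ i
    assoc     : ∀ {A B C D} {f : A ⇒ B} {g : B ⇒ C} {h : C ⇒ D} →
                (h ∘ g) ∘ f ≈ h ∘ (g ∘ f)
    identityˡ : ∀ {A B} {f : A ⇒ B} → id ∘ f ≈ f
    identityʳ : ∀ {A B} {f : A ⇒ B} → f ∘ id ≈ f

  module Eq {A B : Obj} = IsEquivalence (equiv {A} {B})

  hom-setoid : Obj → Obj → Setoid ℓ e
  hom-setoid A B = record { Carrier = A ⇒ B ; _≈_ = _≈_ ; isEquivalence = equiv }

  ≈-refl : ∀ {A B} {f : A ⇒ B} → f ≈ f
  ≈-refl = Eq.refl
  ≈-sym : ∀ {A B} {f g : A ⇒ B} → f ≈ g → g ≈ f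
  ≈-sym = Eq.sym
  ≈-trans : ∀ {A B} {f g h : A ⇒ B} → f ≈ g → g ≈ h → f ≈ h
  ≈-trans = Eq.trans

  ∘ˡ : ∀ {A B C} {f h : B ⇒ C} {g : A ⇒ B} → f ≈ h → f ∘ g ≈ h ∘ g
  ∘ˡ p = ∘-resp-≈ p ≈-refl
  ∘ʳ : ∀ {A B C} {f : B ⇒ C} {g i : A ⇒ B} → g ≈ i → f ∘ g ≈ f ∘ i
  ∘ʳ p = ∘-resp-≈ ≈-refl p

record Groupoid (o ℓ e : Level) : Set (lsuc (o ⊔ ℓ ⊔ e)) where
  field
    category : Category o ℓ e
  open Category category public
  field
    _⁻¹       : ∀ {A B} → A ⇒ B → B ⇒ A
    inverseˡ  : ∀ {A B} {f : A ⇒ B} → f ⁻¹ ∘ f ≈ id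
    inverseʳ  : ∀ {A B} {f : A ⇒ B} → f ∘ f ⁻¹ ≈ id

record Functor {o ℓ e o' ℓ' e'} (X : Groupoid o ℓ e) (Y : Groupoid o' ℓ' e')
       : Set (o ⊔ ℓ ⊔ e ⊔ o' ⊔ ℓ' ⊔ e') where
  private
    module X = Groupoid X
    module Y = Groupoid Y
  field
    F₀           : X.Obj → Y.Obj
    F₁           : ∀ {x y} → x X.⇒ y → F₀ x Y.⇒ F₀ y
    identity     : ∀ {x} → F₁ (X.id {x}) Y.≈ Y.id
    homomorphism : ∀ {x y z} {f : x X.⇒ y} {g : y X.⇒ z} →
                   F₁ (g X.∘ f) Y.≈ F₁ g Y.∘ F₁ f
    F-resp-≈     : ∀ {x y} {f g : x X.⇒ y} → f X.≈ g → F₁ f Y.≈ F₁ g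

idF : ∀ {o ℓ e} (X : Groupoid o ℓ e) → Functor X X
idF X = record
  { F₀ = λ x → x ; F₁ = λ f → f ; identity = ≈-refl
  ; homomorphism = ≈-refl ; F-resp-≈ = λ p → p }
  where open Groupoid X

_∘F_ : ∀ {o ℓ e o' ℓ' e' o'' ℓ'' e''}
         {X : Groupoid o ℓ e} {Y : Groupoid o' ℓ' e'} {Z : Groupoid o'' ℓ'' e''} →
       Functor Y Z → Functor X Y → Functor X Z
_∘F_ {Z = Z} G F = record
  { F₀ = λ x → G.F₀ (F.F₀ x)
  ; F₁ = λ f → G.F₁ (F.F₁ f)
  ; identity = Z.≈-trans (G.F-resp-≈ F.identity) G.identity
  ; homomorphism = Z.≈-trans (G.F-resp-≈ F.homomorphism) G.homomorphism
  ; F-resp-≈ = λ p → G.F-resp-≈ (F.F-resp-≈ p) }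
  where
    module G = Functor G
    module F = Functor F
    module Z = Groupoid Z

-- Natural transformations between functors of groupoids
-- (automatically natural isomorphisms, since the target is a groupoid).
record NatTrans {o ℓ e o' ℓ' e'} {X : Groupoid o ℓ e} {Y : Groupoid o' ℓ' e'}
       (F G : Functor X Y) : Set (o ⊔ ℓ ⊔ e ⊔ o' ⊔ ℓ' ⊔ e') where
  private
    module X = Groupoid X
    module Y = Groupoid Y
    module F = Functor F
    module G = Functor G
  field
    η       : ∀ x → F.F₀ x Y.⇒ G.F₀ x
    commute : ∀ {x y} (f : x X.⇒ y) → η y Y.∘ F.F₁ f Y.≈ G.F₁ f Y.∘ η x

record CartesianClosed {o ℓ e} (R : Category o ℓ e) : Set (o ⊔ ℓ ⊔ e) where
  open Category R
  infixr 7 _×₀_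
  infixr 8 _^_
  field
    𝟙        : Obj
    !        : ∀ {A} → A ⇒ 𝟙
    !-unique : ∀ {A} (f : A ⇒ 𝟙) → f ≈ !
    _×₀_     : Obj → Obj → Obj
    π₁       : ∀ {A B} → A ×₀ B ⇒ A
    π₂       : ∀ {A B} → A ×₀ B ⇒ B
    ⟨_,_⟩    : ∀ {C A B} → C ⇒ A → C ⇒ B → C ⇒ A ×₀ B
    project₁ : ∀ {C A B} {f : C ⇒ A} {g : C ⇒ B} → π₁ ∘ ⟨ f , g ⟩ ≈ f
    project₂ : ∀ {C A B} {f : C ⇒ A} {g : C ⇒ B} → π₂ ∘ ⟨ f , g ⟩ ≈ g
    ⟨⟩-unique : ∀ {C A B} {f : C ⇒ A} {g : C ⇒ B} {h : C ⇒ A ×₀ B} →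
                π₁ ∘ h ≈ f → π₂ ∘ h ≈ g → h ≈ ⟨ f , g ⟩
    _^_      : Obj → Obj → Obj
    eval     : ∀ {A B} → (B ^ A) ×₀ A ⇒ B
    curry    : ∀ {C A B} → C ×₀ A ⇒ B → C ⇒ B ^ A
    eval-β   : ∀ {C A B} {f : C ×₀ A ⇒ B} →
               eval ∘ ⟨ curry f ∘ π₁ , π₂ ⟩ ≈ f
    curry-unique : ∀ {C A B} {f : C ×₀ A ⇒ B} {g : C ⇒ B ^ A} →
               eval ∘ ⟨ g ∘ π₁ , π₂ ⟩ ≈ f → g ≈ curry f

  ⟨⟩-cong : ∀ {C A B} {f f' : C ⇒ A} {g g' : C ⇒ B} → f ≈ f' → g ≈ g' → ⟨ f , g ⟩ ≈ ⟨ f' , g' ⟩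
  ⟨⟩-cong p q = ⟨⟩-unique (≈-trans project₁ p) (≈-trans project₂ q)

  ⟨⟩∘ : ∀ {D C A B} {f : C ⇒ A} {g : C ⇒ B} {h : D ⇒ C} → ⟨ f , g ⟩ ∘ h ≈ ⟨ f ∘ h , g ∘ h ⟩
  ⟨⟩∘ = ⟨⟩-unique (≈-trans (≈-sym assoc) (∘ˡ project₁)) (≈-trans (≈-sym assoc) (∘ˡ project₂))

  curry-cong : ∀ {C A B} {f g : C ×₀ A ⇒ B} → f ≈ g → curry f ≈ curry g
  curry-cong p = curry-unique (≈-trans eval-β p)

  curry∘ : ∀ {D C A B} {f : C ×₀ A ⇒ B} {h : D ⇒ C} →
           curry f ∘ h ≈ curry (f ∘ ⟨ h ∘ π₁ , π₂ ⟩)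
  curry∘ {f = f} {h} = curry-unique (begin
      eval ∘ ⟨ (curry f ∘ h) ∘ π₁ , π₂ ⟩
        ≈⟨ ∘ʳ (⟨⟩-cong (≈-trans assoc (≈-trans (∘ʳ (≈-sym project₁)) (≈-sym assoc)))
                        (≈-sym project₂)) ⟩
      eval ∘ ⟨ (curry f ∘ π₁) ∘ ⟨ h ∘ π₁ , π₂ ⟩ , π₂ ∘ ⟨ h ∘ π₁ , π₂ ⟩ ⟩
        ≈⟨ ∘ʳ (≈-sym ⟨⟩∘) ⟩
      eval ∘ (⟨ curry f ∘ π₁ , π₂ ⟩ ∘ ⟨ h ∘ π₁ , π₂ ⟩)
        ≈⟨ ≈-sym assoc ⟩
      (eval ∘ ⟨ curry f ∘ π₁ , π₂ ⟩) ∘ ⟨ h ∘ π₁ , π₂ ⟩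
        ≈⟨ ∘ˡ eval-β ⟩
      f ∘ ⟨ h ∘ π₁ , π₂ ⟩ ∎)
    where open SetoidR (hom-setoid _ _)

-- Intervals (internal cogroupoids with 𝕀₀ = 𝟙)

module _ {o ℓ e} {R : Category o ℓ e} (C : CartesianClosed R) where
  open Category R
  open CartesianClosed C

  record IntervalData : Set (o ⊔ ℓ ⊔ e) where
    field
      𝕀₁ 𝕀₂ 𝕀₃ : Obj
      0ᵢ 1ᵢ    : 𝟙 ⇒ 𝕀₁
      ⋆        : 𝕀₁ ⇒ 𝟙
      σ        : 𝕀₁ ⇒ 𝕀₁
      i₀ i₁ c₂ : 𝕀₁ ⇒ 𝕀₂          -- c₂ is the map called 2 in the paper
      j₀ j₁    : 𝕀₂ ⇒ 𝕀₃
      square₁        : i₀ ∘ 1ᵢ ≈ i₁ ∘ 0ᵢ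
      [_,_]⟨_⟩       : ∀ {A} (β α : 𝕀₁ ⇒ A) → α ∘ 1ᵢ ≈ β ∘ 0ᵢ → 𝕀₂ ⇒ A
      copair-i₀      : ∀ {A} {β α : 𝕀₁ ⇒ A} {p : α ∘ 1ᵢ ≈ β ∘ 0ᵢ} → [ β , α ]⟨ p ⟩ ∘ i₀ ≈ α
      copair-i₁      : ∀ {A} {β α : 𝕀₁ ⇒ A} {p : α ∘ 1ᵢ ≈ β ∘ 0ᵢ} → [ β , α ]⟨ p ⟩ ∘ i₁ ≈ β
      copair-unique  : ∀ {A} {β α : 𝕀₁ ⇒ A} {p : α ∘ 1ᵢ ≈ β ∘ 0ᵢ} {h : 𝕀₂ ⇒ A} →
                       h ∘ i₀ ≈ α → h ∘ i₁ ≈ β → h ≈ [ β , α ]⟨ p ⟩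
      square₂        : j₁ ∘ i₀ ≈ j₀ ∘ i₁
      copair₃        : ∀ {A} (u v : 𝕀₂ ⇒ A) → u ∘ i₀ ≈ v ∘ i₁ → 𝕀₃ ⇒ A
      copair₃-j₁     : ∀ {A} {u v : 𝕀₂ ⇒ A} {p : u ∘ i₀ ≈ v ∘ i₁} → copair₃ u v p ∘ j₁ ≈ u
      copair₃-j₀     : ∀ {A} {u v : 𝕀₂ ⇒ A} {p : u ∘ i₀ ≈ v ∘ i₁} → copair₃ u v p ∘ j₀ ≈ v
      copair₃-unique : ∀ {A} {u v : 𝕀₂ ⇒ A} {p : u ∘ i₀ ≈ v ∘ i₁} {h : 𝕀₃ ⇒ A} →
                       h ∘ j₁ ≈ u → h ∘ j₀ ≈ v → h ≈ copair₃ u v p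
      c₂-0 : c₂ ∘ 0ᵢ ≈ i₀ ∘ 0ᵢ
      c₂-1 : c₂ ∘ 1ᵢ ≈ i₁ ∘ 1ᵢ
      σ-0  : σ ∘ 0ᵢ ≈ 1ᵢ
      σ-1  : σ ∘ 1ᵢ ≈ 0ᵢ

  module ΠData (𝕀 : IntervalData) where
    open IntervalData 𝕀

    PiHom : (A : Obj) → 𝟙 ⇒ A → 𝟙 ⇒ A → Set (ℓ ⊔ e)
    PiHom A a b = Σ[ α ∈ 𝕀₁ ⇒ A ] (α ∘ 0ᵢ ≈ a × α ∘ 1ᵢ ≈ b)

    ⋆0 : ⋆ ∘ 0ᵢ ≈ id
    ⋆0 = ≈-trans (!-unique _) (≈-sym (!-unique _))
    ⋆1 : ⋆ ∘ 1ᵢ ≈ id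
    ⋆1 = ≈-trans (!-unique _) (≈-sym (!-unique _))

    idΠ : ∀ {A} (a : 𝟙 ⇒ A) → PiHom A a a
    idΠ a = a ∘ ⋆ , ≈-trans assoc (≈-trans (∘ʳ ⋆0) identityʳ)
                  , ≈-trans assoc (≈-trans (∘ʳ ⋆1) identityʳ)

    compΠ : ∀ {A} {a b c : 𝟙 ⇒ A} → PiHom A b c → PiHom A a b → PiHom A a c
    compΠ (β , β0 , β1) (α , α0 , α1) =
        [ β , α ]⟨ p ⟩ ∘ c₂
      , ≈-trans assoc (≈-trans (∘ʳ c₂-0) (≈-trans (≈-sym assoc)
          (≈-trans (∘ˡ copair-i₀) α0)))
      , ≈-trans assoc (≈-trans (∘ʳ c₂-1) (≈-trans (≈-sym assoc)
          (≈-trans (∘ˡ copair-i₁) β1)))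
      where p = ≈-trans α1 (≈-sym β0)

    invΠ : ∀ {A} {a b : 𝟙 ⇒ A} → PiHom A a b → PiHom A b a
    invΠ (α , α0 , α1) = α ∘ σ , ≈-trans assoc (≈-trans (∘ʳ σ-0) α1)
                               , ≈-trans assoc (≈-trans (∘ʳ σ-1) α0)

    ΠF : ∀ {A B} (f : A ⇒ B) {a b : 𝟙 ⇒ A} → PiHom A a b → PiHom B (f ∘ a) (f ∘ b)
    ΠF f (α , α0 , α1) = f ∘ α , ≈-trans assoc (∘ʳ α0) , ≈-trans assoc (∘ʳ α1)

  -- the cogroupoid axioms, in the equivalent form "Π A is a groupoid for every A"
  record CogroupoidLaws (𝕀 : IntervalData) : Set (o ⊔ ℓ ⊔ e) where
    open ΠData 𝕀
    field
      Π-assoc : ∀ {A} {a b c d : 𝟙 ⇒ A}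
                  (α : PiHom A a b) (β : PiHom A b c) (γ : PiHom A c d) →
                proj₁ (compΠ (compΠ γ β) α) ≈ proj₁ (compΠ γ (compΠ β α))
      Π-identityˡ : ∀ {A} {a b : 𝟙 ⇒ A} (α : PiHom A a b) →
                    proj₁ (compΠ (idΠ b) α) ≈ proj₁ α
      Π-identityʳ : ∀ {A} {a b : 𝟙 ⇒ A} (α : PiHom A a b) →
                    proj₁ (compΠ α (idΠ a)) ≈ proj₁ α
      Π-inverseˡ  : ∀ {A} {a b : 𝟙 ⇒ A} (α : PiHom A a b) →
                    proj₁ (compΠ (invΠ α) α) ≈ proj₁ (idΠ a)
      Π-inverseʳ  : ∀ {A} {a b : 𝟙 ⇒ A} (α : PiHom A a b) →
                    proj₁ (compΠ α (invΠ α)) ≈ proj₁ (idΠ b)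

  record Interval : Set (o ⊔ ℓ ⊔ e) where
    field
      intervalData : IntervalData
      laws         : CogroupoidLaws intervalData
    open IntervalData intervalData public
    open ΠData intervalData public
    open CogroupoidLaws laws public

module _ {o ℓ e} {R : Category o ℓ e} {C : CartesianClosed R} (𝕀 : Interval C) where
  open Category R
  open CartesianClosed C
  open Interval 𝕀

  record Homotopy {A B : Obj} (f g : A ⇒ B) : Set (ℓ ⊔ e) where
    field
      H   : A ×₀ 𝕀₁ ⇒ B
      at0 : H ∘ ⟨ id , 0ᵢ ∘ ! ⟩ ≈ f
      at1 : H ∘ ⟨ id , 1ᵢ ∘ ! ⟩ ≈ g

  private
    transp : ∀ {A B} → A ×₀ 𝕀₁ ⇒ B → 𝕀₁ ⇒ B ^ A
    transp H = curry (H ∘ ⟨ π₂ , π₁ ⟩)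

    transp-end : ∀ {A B} {H : A ×₀ 𝕀₁ ⇒ B} {g : A ⇒ B} (c : 𝟙 ⇒ 𝕀₁) →
                 H ∘ ⟨ id , c ∘ ! ⟩ ≈ g → transp H ∘ c ≈ curry (g ∘ π₂)
    transp-end {H = H} {g} c p = ≈-trans curry∘ (curry-cong (begin
        (H ∘ ⟨ π₂ , π₁ ⟩) ∘ ⟨ c ∘ π₁ , π₂ ⟩
          ≈⟨ assoc ⟩
        H ∘ (⟨ π₂ , π₁ ⟩ ∘ ⟨ c ∘ π₁ , π₂ ⟩)
          ≈⟨ ∘ʳ (≈-trans ⟨⟩∘ (⟨⟩-cong project₂ project₁)) ⟩
        H ∘ ⟨ π₂ , c ∘ π₁ ⟩
          ≈⟨ ∘ʳ (⟨⟩-cong (≈-sym identityˡ)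
                 (∘ʳ (≈-trans (!-unique _) (≈-sym (!-unique _))))) ⟩
        H ∘ ⟨ id ∘ π₂ , c ∘ (! ∘ π₂) ⟩
          ≈⟨ ∘ʳ (⟨⟩-cong ≈-refl (≈-sym assoc)) ⟩
        H ∘ ⟨ id ∘ π₂ , (c ∘ !) ∘ π₂ ⟩
          ≈⟨ ∘ʳ (≈-sym ⟨⟩∘) ⟩
        H ∘ (⟨ id , c ∘ ! ⟩ ∘ π₂)
          ≈⟨ ≈-sym assoc ⟩
        (H ∘ ⟨ id , c ∘ ! ⟩) ∘ π₂
          ≈⟨ ∘ˡ p ⟩
        g ∘ π₂ ∎))
      where open SetoidR (hom-setoid _ _)

  -- [H' , H] : A × 𝕀₂ → B, the map induced on the pushout A × 𝕀₂
  -- (A × - preserves the pushout since R is cartesian closed)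
  htpy-copair : ∀ {A B} {f g h : A ⇒ B} → Homotopy g h → Homotopy f g → A ×₀ 𝕀₂ ⇒ B
  htpy-copair {g = g} H' H =
    eval ∘ ⟨ [ transp (Homotopy.H H') , transp (Homotopy.H H) ]⟨ p ⟩ ∘ π₂ , π₁ ⟩
    where
      p = ≈-trans (transp-end 1ᵢ (Homotopy.at1 H)) (≈-sym (transp-end 0ᵢ (Homotopy.at0 H')))

  _⊚_ : ∀ {A B} {f g h : A ⇒ B} → Homotopy g h → Homotopy f g → A ×₀ 𝕀₁ ⇒ B
  H' ⊚ H = htpy-copair H' H ∘ ⟨ π₁ , c₂ ∘ π₂ ⟩

  -- boundary of a map S : A × 𝕀₁ × 𝕀₁ → B, S(a,s,t):
  --   h₀ = S(-,-,0), h₁ = S(-,-,1), v₀ = S(-,0,-), v₁ = S(-,1,-)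
  record IsBoundary {A B : Obj} {f₀₀ f₀₁ f₁₀ f₁₁ : A ⇒ B}
         (h₀ : Homotopy f₀₀ f₁₀) (h₁ : Homotopy f₀₁ f₁₁)
         (v₀ : Homotopy f₀₀ f₀₁) (v₁ : Homotopy f₁₀ f₁₁)
         (S : (A ×₀ 𝕀₁) ×₀ 𝕀₁ ⇒ B) : Set e where
    field
      bd-h₀ : S ∘ ⟨ id , 0ᵢ ∘ ! ⟩ ≈ Homotopy.H h₀
      bd-h₁ : S ∘ ⟨ id , 1ᵢ ∘ ! ⟩ ≈ Homotopy.H h₁
      bd-v₀ : S ∘ ⟨ ⟨ π₁ , 0ᵢ ∘ ! ⟩ , π₂ ⟩ ≈ Homotopy.H v₀
      bd-v₁ : S ∘ ⟨ ⟨ π₁ , 1ᵢ ∘ ! ⟩ , π₂ ⟩ ≈ Homotopy.H v₁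

  -- ∂_R is an isomorphism: every commuting square of homotopies is the
  -- boundary of a unique map A × 𝕀₁ × 𝕀₁ → B
  ∂-IsIso : Set (o ⊔ ℓ ⊔ e)
  ∂-IsIso = ∀ {A B : Obj} {f₀₀ f₀₁ f₁₀ f₁₁ : A ⇒ B}
              (h₀ : Homotopy f₀₀ f₁₀) (h₁ : Homotopy f₀₁ f₁₁)
              (v₀ : Homotopy f₀₀ f₀₁) (v₁ : Homotopy f₁₀ f₁₁) →
              v₁ ⊚ h₀ ≈ h₁ ⊚ v₀ →
              Σ[ S ∈ (A ×₀ 𝕀₁) ×₀ 𝕀₁ ⇒ B ]
                (IsBoundary h₀ h₁ v₀ v₁ S ×
                 (∀ (S' : (A ×₀ 𝕀₁) ×₀ 𝕀₁ ⇒ B) → IsBoundary h₀ h₁ v₀ v₁ S' → S' ≈ S))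

module _ {o ℓ e} {R : Category o ℓ e} {C : CartesianClosed R} (𝕀 : Interval C) where
  open Category R
  open CartesianClosed C
  open Interval 𝕀

  record RealizabilityFunctor {a b c} (X : Groupoid a b c) (A : Obj)
         : Set (a ⊔ b ⊔ c ⊔ ℓ ⊔ e) where
    private module X = Groupoid X
    field
      obj      : X.Obj → 𝟙 ⇒ A
      hom      : ∀ {x y} → x X.⇒ y → PiHom A (obj x) (obj y)
      hom-resp : ∀ {x y} {f g : x X.⇒ y} → f X.≈ g → proj₁ (hom f) ≈ proj₁ (hom g)
      hom-id   : ∀ {x} → proj₁ (hom (X.id {x})) ≈ proj₁ (idΠ (obj x))
      hom-∘    : ∀ {x y z} {f : x X.⇒ y} {g : y X.⇒ z} →
                 proj₁ (hom (g X.∘ f)) ≈ proj₁ (compΠ (hom g) (hom f))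

  record PGAsm (a b c : Level) : Set (lsuc (a ⊔ b ⊔ c) ⊔ o ⊔ ℓ ⊔ e) where
    field
      Gpd  : Groupoid a b c
      RTy  : Obj
      real : RealizabilityFunctor Gpd RTy

  Modest : ∀ {a b c} → PGAsm a b c → Set (a ⊔ b ⊔ c ⊔ ℓ ⊔ e)
  Modest X =
    (∀ {x y} (α : PiHom RTy (obj x) (obj y)) → Σ[ f ∈ x G.⇒ y ] proj₁ (hom f) ≈ proj₁ α) ×
    (∀ {x y} {f g : x G.⇒ y} → proj₁ (hom f) ≈ proj₁ (hom g) → f G.≈ g)
    where
      open PGAsm X
      module G = Groupoid Gpd
      open RealizabilityFunctor real

  -- The realizability condition on an assignment (F₀ , F₁) from a
  -- (raw) realized groupoid to an assembly Y: there are e : A → B and a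
  -- natural iso ε : Π(e) ‖-‖ ⇒ ‖-‖_Y F.
  Realized : ∀ {a b a' b' c'}
             {XO : Set a} (XH : XO → XO → Set b) {A : Obj}
             (objX : XO → 𝟙 ⇒ A)
             (homX : ∀ {x y} → XH x y → PiHom A (objX x) (objX y))
             (Y : PGAsm a' b' c') →
             (F₀ : XO → Groupoid.Obj (PGAsm.Gpd Y)) →
             (F₁ : ∀ {x y} → XH x y → Groupoid._⇒_ (PGAsm.Gpd Y) (F₀ x) (F₀ y)) →
             Set (a ⊔ b ⊔ ℓ ⊔ e)
  Realized XH {A} objX homX Y F₀ F₁ =
    Σ[ ε₀ ∈ A ⇒ RTy ]
    Σ[ ε ∈ (∀ x → PiHom RTy (ε₀ ∘ objX x) (obj (F₀ x))) ]
      (∀ {x y} (f : XH x y) →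
         proj₁ (compΠ (ε y) (ΠF ε₀ (homX {x} {y} f))) ≈ proj₁ (compΠ (hom (F₁ {x} {y} f)) (ε x)))
    where
      open PGAsm Y
      open RealizabilityFunctor real

  IsMorphism : ∀ {a b c a' b' c'} (X : PGAsm a b c) (Y : PGAsm a' b' c') →
               Functor (PGAsm.Gpd X) (PGAsm.Gpd Y) → Set (a ⊔ b ⊔ ℓ ⊔ e)
  IsMorphism X Y F =
    Realized (Groupoid._⇒_ (PGAsm.Gpd X)) (RealizabilityFunctor.obj (PGAsm.real X))
             (RealizabilityFunctor.hom (PGAsm.real X)) Y (Functor.F₀ F) (Functor.F₁ F)

  -- The product X × 𝐈₁ with the walking isomorphism 𝐈₁ (objects false = 0,
  -- true = 1; exactly one morphism t → t' for all t, t').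

  data WIHom (t t' : Bool) : Set where
    wi : WIHom t t'

  pt : Bool → 𝟙 ⇒ 𝕀₁
  pt false = 0ᵢ
  pt true  = 1ᵢ

  private
    iΠ : PiHom 𝕀₁ 0ᵢ 1ᵢ
    iΠ = id , identityˡ , identityˡ

  ‖_‖𝐈 : ∀ {t t'} → WIHom t t' → PiHom 𝕀₁ (pt t) (pt t')
  ‖_‖𝐈 {false} {false} _ = idΠ 0ᵢ
  ‖_‖𝐈 {false} {true}  _ = iΠ
  ‖_‖𝐈 {true}  {false} _ = invΠ iΠ
  ‖_‖𝐈 {true}  {true}  _ = idΠ 1ᵢ

  pairΠ : ∀ {A B} {a a' : 𝟙 ⇒ A} {b b' : 𝟙 ⇒ B} →
          PiHom A a a' → PiHom B b b' → PiHom (A ×₀ B) ⟨ a , b ⟩ ⟨ a' , b' ⟩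
  pairΠ (α , α0 , α1) (β , β0 , β1) =
    ⟨ α , β ⟩ , ≈-trans ⟨⟩∘ (⟨⟩-cong α0 β0) , ≈-trans ⟨⟩∘ (⟨⟩-cong α1 β1)

  module _ {a b c} (X : PGAsm a b c) where
    private
      module X = Groupoid (PGAsm.Gpd X)
      open RealizabilityFunctor (PGAsm.real X)

    ×𝐈-Hom : X.Obj × Bool → X.Obj × Bool → Set b
    ×𝐈-Hom (x , t) (y , t') = x X.⇒ y × WIHom t t'

    ×𝐈-obj : X.Obj × Bool → 𝟙 ⇒ PGAsm.RTy X ×₀ 𝕀₁
    ×𝐈-obj (x , t) = ⟨ obj x , pt t ⟩

    ×𝐈-hom : ∀ {p q} → ×𝐈-Hom p q → PiHom (PGAsm.RTy X ×₀ 𝕀₁) (×𝐈-obj p) (×𝐈-obj q)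
    ×𝐈-hom {x , t} {y , t'} (f , i) = pairΠ (hom f) (‖_‖𝐈 {t} {t'} i)

  -- 2-cells: a natural transformation η : F ⇒ G (of functors of groupoids)
  -- is a 2-cell of PGAsm iff the functor Φ_η : X × 𝐈₁ → Y restricting to F
  -- at 0 and to G at 1 (and sending (f , i) to η ∘ F f) is realized.

  module _ {a b c a' b' c'} (X : PGAsm a b c) (Y : PGAsm a' b' c')
           {F G : Functor (PGAsm.Gpd X) (PGAsm.Gpd Y)} (η : NatTrans F G) where
    private
      module X = Groupoid (PGAsm.Gpd X)
      module Y = Groupoid (PGAsm.Gpd Y)
      module F = Functor F
      module G = Functor G
      module η = NatTrans η

    Φ₀ : X.Obj × Bool → Y.Obj
    Φ₀ (x , false) = F.F₀ x
    Φ₀ (x , true)  = G.F₀ x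

    Φ₁ : ∀ {p q} → ×𝐈-Hom X p q → Φ₀ p Y.⇒ Φ₀ q
    Φ₁ {_ , false} {y , false} (f , _) = F.F₁ f
    Φ₁ {_ , false} {y , true}  (f , _) = η.η y Y.∘ F.F₁ f
    Φ₁ {_ , true}  {y , false} (f , _) = η.η y Y.⁻¹ Y.∘ G.F₁ f
    Φ₁ {_ , true}  {y , true}  (f , _) = G.F₁ f

    Is2Cell : Set (a ⊔ b ⊔ ℓ ⊔ e)
    Is2Cell = Realized (×𝐈-Hom X) (×𝐈-obj X) (λ {p} {q} → ×𝐈-hom X {p} {q}) Y Φ₀
                         (λ {p} {q} → Φ₁ {p} {q})

  mkPGAsm : ∀ {a b c} (Y : Groupoid a b c) (B : Obj) → RealizabilityFunctor Y B → PGAsm a b c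
  mkPGAsm Y B r = record { Gpd = Y ; RTy = B ; real = r }

-- Give Y the realizer type of X and realize y by ‖G y‖.  Then G is realized by the
-- identity, and realizing F into Y is literally realizing G ∘ F into X, which the
-- components of φ provide, starting from the identity realizer of id_X.  A natural
-- isomorphism η : H ⇒ K out of a realized H is a realized 2-cell: over (x , 1) use
-- ‖η x‖ after the realizer of H at x.  Modesty transfers because G, half of an
-- equivalence, is full and faithful.
module Submission where

open import Defs
open import Level using (Level; _⊔_)
open import Data.Product using (Σ; Σ-syntax; _×_; _,_; proj₁)
open import Data.Bool using (true; false)
import Relation.Binary.Reasoning.Setoid as SetoidR

module CategoryProperties {o ℓ e} (𝒞 : Category o ℓ e) where
  open Category 𝒞

  glue : ∀ {A B C D E F} {εx : A ⇒ B} {u : A ⇒ C} {h : B ⇒ D} {εy : C ⇒ D}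
           {θx : B ⇒ E} {k : E ⇒ F} {θy : D ⇒ F} →
         θy ∘ h ≈ k ∘ θx → εy ∘ u ≈ h ∘ εx → (θy ∘ εy) ∘ u ≈ k ∘ (θx ∘ εx)
  glue {εx = εx} {u} {h} {εy} {θx} {k} {θy} sq₁ sq₂ = begin
    (θy ∘ εy) ∘ u  ≈⟨ assoc ⟩
    θy ∘ (εy ∘ u)  ≈⟨ ∘ʳ sq₂ ⟩
    θy ∘ (h ∘ εx)  ≈⟨ ≈-sym assoc ⟩
    (θy ∘ h) ∘ εx  ≈⟨ ∘ˡ sq₁ ⟩
    (k ∘ θx) ∘ εx  ≈⟨ assoc ⟩
    k ∘ (θx ∘ εx)  ∎
    where open SetoidR (hom-setoid _ _)

module GroupoidProperties {o ℓ e} (Z : Groupoid o ℓ e) where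
  open Groupoid Z

  ⁻¹∘-cancel : ∀ {A B C} {f : A ⇒ B} {g : C ⇒ A} → f ⁻¹ ∘ (f ∘ g) ≈ g
  ⁻¹∘-cancel = ≈-trans (≈-sym assoc) (≈-trans (∘ˡ inverseˡ) identityˡ)

  ∘⁻¹-cancel : ∀ {A B C} {f : A ⇒ B} {g : C ⇒ B} → f ∘ (f ⁻¹ ∘ g) ≈ g
  ∘⁻¹-cancel = ≈-trans (≈-sym assoc) (≈-trans (∘ˡ inverseʳ) identityˡ)

  ∘-cancelˡ : ∀ {A B C} {f : B ⇒ C} {g h : A ⇒ B} → f ∘ g ≈ f ∘ h → g ≈ h
  ∘-cancelˡ p = ≈-trans (≈-sym ⁻¹∘-cancel) (≈-trans (∘ʳ p) ⁻¹∘-cancel)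

  ∘-cancelʳ : ∀ {A B C} {f : A ⇒ B} {g h : B ⇒ C} → g ∘ f ≈ h ∘ f → g ≈ h
  ∘-cancelʳ {f = f} {g} {h} p = begin
    g                  ≈⟨ ≈-sym identityʳ ⟩
    g ∘ id             ≈⟨ ∘ʳ (≈-sym inverseʳ) ⟩
    g ∘ (f ∘ f ⁻¹)     ≈⟨ ≈-sym assoc ⟩
    (g ∘ f) ∘ f ⁻¹     ≈⟨ ∘ˡ p ⟩
    (h ∘ f) ∘ f ⁻¹     ≈⟨ assoc ⟩
    h ∘ (f ∘ f ⁻¹)     ≈⟨ ∘ʳ inverseʳ ⟩
    h ∘ id             ≈⟨ identityʳ ⟩
    h                  ∎
    where open SetoidR (hom-setoid _ _)

module FunctorProperties {o ℓ e o' ℓ' e'} {X : Groupoid o ℓ e} {Y : Groupoid o' ℓ' e'} where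
  private
    module X = Groupoid X
    module Y = Groupoid Y

  F-resp-square : (F : Functor X Y) → let open Functor F in
                  ∀ {A B C D} {f : A X.⇒ B} {g : A X.⇒ C} {h : B X.⇒ D} {k : C X.⇒ D} →
                  h X.∘ f X.≈ k X.∘ g → F₁ h Y.∘ F₁ f Y.≈ F₁ k Y.∘ F₁ g
  F-resp-square F sq = Y.≈-trans (Y.≈-sym homomorphism) (Y.≈-trans (F-resp-≈ sq) homomorphism)
    where open Functor F

  Faithful : Functor X Y → Set (o ⊔ ℓ ⊔ e ⊔ e')
  Faithful F = ∀ {x y} {u v : x X.⇒ y} → F₁ u Y.≈ F₁ v → u X.≈ v
    where open Functor F

  Full : Functor X Y → Set (o ⊔ ℓ ⊔ ℓ' ⊔ e')
  Full F = ∀ {x y} (f : F₀ x Y.⇒ F₀ y) → Σ[ u ∈ x X.⇒ y ] F₁ u Y.≈ f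
    where open Functor F

open FunctorProperties

module _ {o ℓ e} {Z : Groupoid o ℓ e} where
  open Groupoid Z
  open GroupoidProperties Z

  isoFromIdentity⇒faithful : {K : Functor Z Z} → NatTrans (idF Z) K → Faithful K
  isoFromIdentity⇒faithful {K} η {x} {y} {u} {v} Ku≈Kv = ∘-cancelˡ (begin
    η.η y ∘ u        ≈⟨ η.commute u ⟩
    K.F₁ u ∘ η.η x   ≈⟨ ∘ˡ Ku≈Kv ⟩
    K.F₁ v ∘ η.η x   ≈⟨ ≈-sym (η.commute v) ⟩
    η.η y ∘ v        ∎)
    where
      module K = Functor K
      module η = NatTrans η
      open SetoidR (hom-setoid _ _)

module _ {o ℓ e o' ℓ' e'} {X : Groupoid o ℓ e} {Y : Groupoid o' ℓ' e'}
         (F : Functor X Y) (G : Functor Y X)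
         (φ : NatTrans (idF X) (G ∘F F)) (ψ : NatTrans (idF Y) (F ∘F G)) where
  private
    module X = Groupoid X
    module Y = Groupoid Y
    module F = Functor F
    module G = Functor G
    module ψ = NatTrans ψ

  equivalence-faithful : Faithful G
  equivalence-faithful p = isoFromIdentity⇒faithful ψ (F.F-resp-≈ p)

  equivalence-full : Full G
  equivalence-full {y} {y'} f = g , isoFromIdentity⇒faithful φ (G.F-resp-≈ FGg≈Ff)
    where
      open Y
      open GroupoidProperties Y
      g : y ⇒ y'
      g = ψ.η y' ⁻¹ ∘ (F.F₁ f ∘ ψ.η y)
      FGg≈Ff : F.F₁ (G.F₁ g) ≈ F.F₁ f
      FGg≈Ff = ∘-cancelʳ (≈-trans (≈-sym (ψ.commute g)) ∘⁻¹-cancel)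

module _ {o ℓ e} {R : Category o ℓ e} {C : CartesianClosed R} (𝕀 : Interval C) where
  open Category R
  open CartesianClosed C
  open Interval 𝕀

  ∘π₁-⟨⟩ : ∀ {A B C D} {f : A ⇒ D} {g : C ⇒ A} {h : C ⇒ B} → (f ∘ π₁) ∘ ⟨ g , h ⟩ ≈ f ∘ g
  ∘π₁-⟨⟩ = ≈-trans assoc (∘ʳ project₁)

  castΠ : ∀ {A} {a b a' b' : 𝟙 ⇒ A} → PiHom A a b → a' ≈ a → b' ≈ b → PiHom A a' b'
  castΠ (α , α0 , α1) p q = α , ≈-trans α0 (≈-sym p) , ≈-trans α1 (≈-sym q)

  -- compΠ unfolds to a copair, so implicit morphisms of Π A cannot be inferred from
  -- a goal and are passed by name below.
  compΠ-cong : ∀ {A} {a b c a' b' c' : 𝟙 ⇒ A} {β : PiHom A b c} {α : PiHom A a b}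
                 {β' : PiHom A b' c'} {α' : PiHom A a' b'} →
               proj₁ β ≈ proj₁ β' → proj₁ α ≈ proj₁ α' → proj₁ (compΠ β α) ≈ proj₁ (compΠ β' α')
  compΠ-cong q p = ∘ˡ (copair-unique (≈-trans copair-i₀ p) (≈-trans copair-i₁ q))

  ΠGroupoid : Obj → Groupoid ℓ (ℓ ⊔ e) e
  ΠGroupoid A = record
    { category = record
      { Obj = 𝟙 ⇒ A
      ; _⇒_ = PiHom A
      ; _≈_ = λ α β → proj₁ α ≈ proj₁ β
      ; id = λ {a} → idΠ a
      ; _∘_ = compΠ
      ; equiv = record { refl = ≈-refl ; sym = ≈-sym ; trans = ≈-trans }
      ; ∘-resp-≈ = λ {_} {_} {_} {f} {h} {g} {i} → compΠ-cong {β = f} {α = g} {β' = h} {α' = i}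
      ; assoc = λ {_} {_} {_} {_} {f} {g} {h} → Π-assoc f g h
      ; identityˡ = λ {_} {_} {f} → Π-identityˡ f
      ; identityʳ = λ {_} {_} {f} → Π-identityʳ f }
    ; _⁻¹ = invΠ
    ; inverseˡ = λ {_} {_} {f} → Π-inverseˡ f
    ; inverseʳ = λ {_} {_} {f} → Π-inverseʳ f }

  asFunctor : ∀ {a b c} {X : Groupoid a b c} {A : Obj} →
              RealizabilityFunctor 𝕀 X A → Functor X (ΠGroupoid A)
  asFunctor r = record
    { F₀ = obj ; F₁ = hom ; identity = hom-id ; homomorphism = hom-∘ ; F-resp-≈ = hom-resp }
    where open RealizabilityFunctor r

  precompose : ∀ {a b c a' b' c'} {X : Groupoid a b c} {Y : Groupoid a' b' c'} {A : Obj} →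
               Functor Y X → RealizabilityFunctor 𝕀 X A → RealizabilityFunctor 𝕀 Y A
  precompose G r = record
    { obj = λ y → obj (G.F₀ y)
    ; hom = λ g → hom (G.F₁ g)
    ; hom-resp = λ p → hom-resp (G.F-resp-≈ p)
    ; hom-id = ≈-trans (hom-resp G.identity) hom-id
    ; hom-∘ = ≈-trans (hom-resp G.homomorphism) hom-∘ }
    where
      module G = Functor G
      open RealizabilityFunctor r

  restrict : ∀ {a b c a' b' c'} {Y : Groupoid a' b' c'} (P : PGAsm 𝕀 a b c) →
             Functor Y (PGAsm.Gpd P) → PGAsm 𝕀 a' b' c'
  restrict {Y = Y} P G = mkPGAsm 𝕀 Y (PGAsm.RTy P) (precompose G (PGAsm.real P))

  module _ {a b a' b' c'} {XO : Set a} {XH : XO → XO → Set b} (Y : PGAsm 𝕀 a' b' c') where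
    private
      module Y = Groupoid (PGAsm.Gpd Y)
      module ΠB = Groupoid (ΠGroupoid (PGAsm.RTy Y))
      open RealizabilityFunctor (PGAsm.real Y)

    Realized-by-id : ∀ {F₀ : XO → Y.Obj} {F₁ : ∀ {x y} → XH x y → F₀ x Y.⇒ F₀ y} →
                     Realized 𝕀 XH (λ x → obj (F₀ x)) (λ f → hom (F₁ f)) Y F₀ F₁
    Realized-by-id {F₀} {F₁} = id , ε , square
      where
        ε : ∀ x → PiHom (PGAsm.RTy Y) (id ∘ obj (F₀ x)) (obj (F₀ x))
        ε x = castΠ (idΠ (obj (F₀ x))) identityˡ ≈-refl
        square : ∀ {x y} (f : XH x y) → ε y ΠB.∘ ΠF id (hom (F₁ f)) ΠB.≈ hom (F₁ f) ΠB.∘ ε x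
        square {x} {y} f = begin
          proj₁ (compΠ (ε y) (ΠF id (hom (F₁ f))))
            ≈⟨ compΠ-cong {β = ε y} {α = ΠF id (hom (F₁ f))}
                        {β' = idΠ (obj (F₀ y))} {α' = hom (F₁ f)} ≈-refl identityˡ ⟩
          proj₁ (compΠ (idΠ (obj (F₀ y))) (hom (F₁ f)))
            ≈⟨ Π-identityˡ (hom (F₁ f)) ⟩
          proj₁ (hom (F₁ f))
            ≈⟨ ≈-sym (Π-identityʳ (hom (F₁ f))) ⟩
          proj₁ (compΠ (hom (F₁ f)) (idΠ (obj (F₀ x))))
            ≈⟨ compΠ-cong {β = hom (F₁ f)} {α = idΠ (obj (F₀ x))}
                        {β' = hom (F₁ f)} {α' = ε x} ≈-refl ≈-refl ⟩
          proj₁ (compΠ (hom (F₁ f)) (ε x))  ∎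
          where open SetoidR (hom-setoid _ _)

    Realized-transport :
      ∀ {A} {objX : XO → 𝟙 ⇒ A} {homX : ∀ {x y} → XH x y → PiHom A (objX x) (objX y)}
        {H₀ F₀ : XO → Y.Obj}
        {H₁ : ∀ {x y} → XH x y → H₀ x Y.⇒ H₀ y} {F₁ : ∀ {x y} → XH x y → F₀ x Y.⇒ F₀ y}
        (θ : ∀ x → H₀ x Y.⇒ F₀ x) →
        (∀ {x y} (f : XH x y) → θ y Y.∘ H₁ f Y.≈ F₁ f Y.∘ θ x) →
        Realized 𝕀 XH objX homX Y H₀ H₁ → Realized 𝕀 XH objX homX Y F₀ F₁
    Realized-transport {homX = homX} {H₁ = H₁} {F₁ = F₁} θ natural (e , ε , square) =
      e , (λ x → hom (θ x) ΠB.∘ ε x) ,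
      λ {x} {y} f → CategoryProperties.glue ΠB.category
        {εx = ε x} {u = ΠF e (homX f)} {h = hom (H₁ f)} {εy = ε y}
        {θx = hom (θ x)} {k = hom (F₁ f)} {θy = hom (θ y)}
        (F-resp-square (asFunctor (PGAsm.real Y)) (natural f)) (square f)

  module _ {a b c a' b' c'} (X : PGAsm 𝕀 a b c) (Y : PGAsm 𝕀 a' b' c') where
    IsMorphism-transport : {H K : Functor (PGAsm.Gpd X) (PGAsm.Gpd Y)} →
                           IsMorphism 𝕀 X Y H → NatTrans H K → IsMorphism 𝕀 X Y K
    IsMorphism-transport {H} {K} H-realized η =
      Realized-transport Y {homX = hom} {H₁ = Functor.F₁ H} {F₁ = Functor.F₁ K}
        (NatTrans.η η) (NatTrans.commute η) H-realized
      where open RealizabilityFunctor (PGAsm.real X)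

  idF-isMorphism : ∀ {a b c} (P : PGAsm 𝕀 a b c) → IsMorphism 𝕀 P P (idF (PGAsm.Gpd P))
  idF-isMorphism P = Realized-by-id P

  restrict-isMorphism : ∀ {a b c a' b' c'} (P : PGAsm 𝕀 a b c) {Y : Groupoid a' b' c'}
                        (G : Functor Y (PGAsm.Gpd P)) → IsMorphism 𝕀 (restrict P G) P G
  restrict-isMorphism P G = Realized-by-id P {F₀ = Functor.F₀ G} {F₁ = Functor.F₁ G}

  module _ {a b c a' b' c'} (X : PGAsm 𝕀 a b c) (Y : PGAsm 𝕀 a' b' c')
           {H : Functor (PGAsm.Gpd X) (PGAsm.Gpd Y)} where
    private
      module H = Functor H
      open RealizabilityFunctor

    Realized-×𝐈-constant :
      IsMorphism 𝕀 X Y H →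
      Realized 𝕀 (×𝐈-Hom 𝕀 X) (×𝐈-obj 𝕀 X) (λ {p} {q} → ×𝐈-hom 𝕀 X {p} {q}) Y
               (λ p → H.F₀ (proj₁ p)) (λ f → H.F₁ (proj₁ f))
    Realized-×𝐈-constant (e , ε , square) = e ∘ π₁ , ε′ , square′
      where
        ε′ : ∀ p → PiHom (PGAsm.RTy Y) ((e ∘ π₁) ∘ ×𝐈-obj 𝕀 X p) (obj (PGAsm.real Y) (H.F₀ (proj₁ p)))
        ε′ (x , _) = castΠ (ε x) ∘π₁-⟨⟩ ≈-refl
        square′ : ∀ {p q} (f : ×𝐈-Hom 𝕀 X p q) →
                  proj₁ (compΠ (ε′ q) (ΠF (e ∘ π₁) (×𝐈-hom 𝕀 X {p} {q} f))) ≈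
                  proj₁ (compΠ (hom (PGAsm.real Y) (H.F₁ (proj₁ f))) (ε′ p))
        square′ {x , t} {y , t'} (f , i) = begin
          proj₁ (compΠ (ε′ (y , t')) (ΠF (e ∘ π₁) (×𝐈-hom 𝕀 X {x , t} {y , t'} (f , i))))
            ≈⟨ compΠ-cong {β = ε′ (y , t')} {α = ΠF (e ∘ π₁) (×𝐈-hom 𝕀 X {x , t} {y , t'} (f , i))}
                          {β' = ε y} {α' = ΠF e (hom (PGAsm.real X) f)} ≈-refl ∘π₁-⟨⟩ ⟩
          proj₁ (compΠ (ε y) (ΠF e (hom (PGAsm.real X) f)))
            ≈⟨ square f ⟩
          proj₁ (compΠ (hom (PGAsm.real Y) (H.F₁ f)) (ε x))
            ≈⟨ compΠ-cong {β = hom (PGAsm.real Y) (H.F₁ f)} {α = ε x}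
                          {β' = hom (PGAsm.real Y) (H.F₁ f)} {α' = ε′ (x , t)} ≈-refl ≈-refl ⟩
          proj₁ (compΠ (hom (PGAsm.real Y) (H.F₁ f)) (ε′ (x , t)))  ∎
          where open SetoidR (hom-setoid _ _)

  module _ {a b c a' b' c'} (X : PGAsm 𝕀 a b c) (Y : PGAsm 𝕀 a' b' c')
           {H K : Functor (PGAsm.Gpd X) (PGAsm.Gpd Y)} (η : NatTrans H K) where
    private
      module Y = Groupoid (PGAsm.Gpd Y)
      module H = Functor H
      module K = Functor K
      module η = NatTrans η
      open GroupoidProperties (PGAsm.Gpd Y)

    Φ-from-H : ∀ p → H.F₀ (proj₁ p) Y.⇒ Φ₀ 𝕀 X Y η p
    Φ-from-H (x , false) = Y.id
    Φ-from-H (x , true)  = η.η x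

    Φ-from-H-natural : ∀ {p q} (f : ×𝐈-Hom 𝕀 X p q) →
                       Φ-from-H q Y.∘ H.F₁ (proj₁ f) Y.≈ Φ₁ 𝕀 X Y η {p} {q} f Y.∘ Φ-from-H p
    Φ-from-H-natural {_ , false} {_ , false} _       = Y.≈-trans Y.identityˡ (Y.≈-sym Y.identityʳ)
    Φ-from-H-natural {_ , false} {_ , true}  _       = Y.≈-sym Y.identityʳ
    Φ-from-H-natural {x , true}  {y , false} (f , _) = begin
      Y.id Y.∘ H.F₁ f                          ≈⟨ Y.identityˡ ⟩
      H.F₁ f                                   ≈⟨ Y.≈-sym ⁻¹∘-cancel ⟩
      η.η y Y.⁻¹ Y.∘ (η.η y Y.∘ H.F₁ f)        ≈⟨ Y.∘ʳ (η.commute f) ⟩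
      η.η y Y.⁻¹ Y.∘ (K.F₁ f Y.∘ η.η x)        ≈⟨ Y.≈-sym Y.assoc ⟩
      (η.η y Y.⁻¹ Y.∘ K.F₁ f) Y.∘ η.η x        ∎
      where open SetoidR (Y.hom-setoid _ _)
    Φ-from-H-natural {_ , true}  {_ , true}  (f , _) = η.commute f

    natTrans-is2Cell : IsMorphism 𝕀 X Y H → Is2Cell 𝕀 X Y η
    natTrans-is2Cell H-realized =
      Realized-transport Y {homX = λ {p} {q} → ×𝐈-hom 𝕀 X {p} {q}}
                           {H₁ = λ f → H.F₁ (proj₁ f)} {F₁ = λ {p} {q} → Φ₁ 𝕀 X Y η {p} {q}}
        Φ-from-H Φ-from-H-natural (Realized-×𝐈-constant X Y {H} H-realized)

  restrict-modest : ∀ {a b c a' b' c'} (P : PGAsm 𝕀 a b c) {Y : Groupoid a' b' c'}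
                    {G : Functor Y (PGAsm.Gpd P)} → Full G → Faithful G →
                    Modest 𝕀 P → Modest 𝕀 (restrict P G)
  restrict-modest P {Y} {G} G-full G-faithful (P-full , P-faithful) =
    restrict-full , λ p → G-faithful (P-faithful p)
    where
      open RealizabilityFunctor (PGAsm.real P)
      module G = Functor G
      restrict-full : ∀ {y y'} (α : PiHom (PGAsm.RTy P) (obj (G.F₀ y)) (obj (G.F₀ y'))) →
                      Σ[ g ∈ Groupoid._⇒_ Y y y' ] proj₁ (hom (G.F₁ g)) ≈ proj₁ α
      restrict-full α with P-full α
      ... | f , ‖f‖≈α with G-full f
      ...   | g , Gg≈f = g , ≈-trans (hom-resp Gg≈f) ‖f‖≈α

mainTheorem6 :
  ∀ {o ℓ e a b c a' b' c' : Level}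
    (R : Category o ℓ e) (C : CartesianClosed R) (𝕀 : Interval C) →
    ∂-IsIso 𝕀 →
    (X : PGAsm 𝕀 a b c) (Y : Groupoid a' b' c')
    (F : Functor (PGAsm.Gpd X) Y) (G : Functor Y (PGAsm.Gpd X))
    (φ : NatTrans (idF (PGAsm.Gpd X)) (G ∘F F))
    (ψ : NatTrans (idF Y) (F ∘F G)) →
    Σ[ B ∈ Category.Obj R ] Σ[ ‖-‖Y ∈ RealizabilityFunctor 𝕀 Y B ]
      (IsMorphism 𝕀 X (mkPGAsm 𝕀 Y B ‖-‖Y) F
        × IsMorphism 𝕀 (mkPGAsm 𝕀 Y B ‖-‖Y) X G
        × Is2Cell 𝕀 X X φ
        × Is2Cell 𝕀 (mkPGAsm 𝕀 Y B ‖-‖Y) (mkPGAsm 𝕀 Y B ‖-‖Y) ψ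
        × (Modest 𝕀 X → Modest 𝕀 (mkPGAsm 𝕀 Y B ‖-‖Y)))
mainTheorem6 R C 𝕀 _ X Y F G φ ψ =
    PGAsm.RTy X , precompose 𝕀 G (PGAsm.real X)
  , IsMorphism-transport 𝕀 X X (idF-isMorphism 𝕀 X) φ
  , restrict-isMorphism 𝕀 X G
  , natTrans-is2Cell 𝕀 X X φ (idF-isMorphism 𝕀 X)
  , natTrans-is2Cell 𝕀 (restrict 𝕀 X G) (restrict 𝕀 X G) ψ (idF-isMorphism 𝕀 (restrict 𝕀 X G))
  , restrict-modest 𝕀 X {G = G} (equivalence-full F G φ ψ) (equivalence-faithful F G φ ψ)
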